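{- For all $n\ge0$, all $0\le k\le n$, and all $a,b,c_0,c_\infty\in\mathbb{C}$, \[E_{n,k}(a,b;c_0,c_\infty)=\sum_{j=k}^n(-1)^{j-k}\binom{j}{k}(c_0+c_\infty)^{\overline{n-j},b}\,S_{n,n-j}(-a,b;c_\infty),\] \[(c_0+c_\infty)^{\overline{n-k},b}\,S_{n,n-k}(-a,b;c_\infty)=\sum_{j=k}^n\binom{j}{k}E_{n,j}(a,b;c_0,c_\infty).\]
   Context: For complex parameters $(\alpha,\beta,\gamma;\alpha',\beta',\gamma')$, the GKP triangle is the unique array $T_{n,k}$, $0\le k\le n$ ($T_{n,k}=0$ if $k<0$ or $k>n$), with $T_{0,0}=1$ and $T_{n+1,k+1}=[\alpha n+\beta(k+1)+\gamma]T_{n,k+1}+[\alpha' n+\beta' k+\gamma']T_{n,k}$ for $n\ge0$, $k\ge-1$. The generalized Stirling (Hsu–Shiue) numbers $S_{n,k}(a,b;r)$ form the GKP triangle with parameters $(-a,b,r;0,0,1)$. The generalized Eulerian numbers $E_{n,k}(a,b;c_0,c_\infty)$ form the GKP triangle with parameters $(-a,b,c_0;\,a+b,-b,c_\infty)$. Generalized factorials: $(x)^{\overline m,b}=x(x+b)\cdots(x+(m-1)b)$, $(x)^{\underline m,b}=x(x-b)\cdots(x-(m-1)b)$, both equal to $1$ when $m=0$. -}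

module Defs where

open import Level using (Level)
open import Data.Nat as ℕ using (ℕ; zero; suc; _∸_)
open import Data.Nat.Combinatorics using (_C_)
open import Algebra.Bundles using (CommutativeRing)

module _ {c ℓ : Level} (R : CommutativeRing c ℓ) where
  open CommutativeRing R using (Carrier; _+_; _*_; -_; 0#; 1#)

  fromℕ : ℕ → Carrier
  fromℕ zero    = 0#
  fromℕ (suc n) = 1# + fromℕ n

  pow : Carrier → ℕ → Carrier
  pow x zero    = 1#
  pow x (suc m) = x * pow x m

  sign : ℕ → Carrier
  sign m = pow (- 1#) m

  rising : Carrier → Carrier → ℕ → Carrier
  rising x b zero    = 1#
  rising x b (suc m) = rising x b m * (x + fromℕ m * b)

  -- T_{n,-1} = 0, so the case k = -1 of the recurrence gives
  -- T_{n+1,0} = (α n + γ) T_{n,0}.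
  GKP : (α β γ α' β' γ' : Carrier) → ℕ → ℕ → Carrier
  GKP α β γ α' β' γ' zero    zero    = 1#
  GKP α β γ α' β' γ' zero    (suc k) = 0#
  GKP α β γ α' β' γ' (suc n) zero    =
    (α * fromℕ n + β * fromℕ 0 + γ) * GKP α β γ α' β' γ' n zero
  GKP α β γ α' β' γ' (suc n) (suc k) =
    (α * fromℕ n + β * fromℕ (suc k) + γ) * GKP α β γ α' β' γ' n (suc k)
    + (α' * fromℕ n + β' * fromℕ k + γ') * GKP α β γ α' β' γ' n k

  S : (a b r : Carrier) → ℕ → ℕ → Carrier
  S a b r = GKP (- a) b r 0# 0# 1#

  E : (a b c₀ c∞ : Carrier) → ℕ → ℕ → Carrier
  E a b c₀ c∞ = GKP (- a) b c₀ (a + b) (- b) c∞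

  -- Σ_{j=k}^{n} f j   (empty sum = 0 when n < k)
  sumFromTo : ℕ → ℕ → (ℕ → Carrier) → Carrier
  sumFromTo k n f = go (suc n ∸ k) k
    where
    go : ℕ → ℕ → Carrier
    go zero    j = 0#
    go (suc m) j = f j + go m (suc j)

-- Both sides are GKP triangles.  Multiplying the Stirling triangle S(-a,b;c∞), with
-- parameters (a,b,c∞;0,0,1), by the rising factorial (c₀+c∞)^{\overline k,b} gives the GKP
-- triangle (a,b,c∞;0,b,c₀+c∞); reading its rows backwards (k ↦ n-k) turns it into
-- F = (b,-b,c₀+c∞;a+b,-b,c∞).  Summing a triangle against C(j,k) w^(j-k), i.e.
-- substituting x ↦ x + w in its row polynomials, maps a GKP triangle with β + wβ′ = 0
-- to the GKP triangle (α+wα′, wβ′, γ+wγ′; α′,β′,γ′).  With w = 1 this sends E to F,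
-- and with w = -1 it sends F back to E; a GKP triangle is determined by its recurrence.

module Submission where

open import Defs
open import Level using (Level; _⊔_)
open import Algebra.Bundles using (CommutativeRing)
open import Data.Nat as ℕ using (ℕ; zero; suc; _≤_; _<_; _∸_; z≤n; s≤s)
import Data.Nat.Properties as ℕ
open import Data.Nat.Combinatorics using (_C_; k>n⇒nCk≡0; nCk+nC[k+1]≡[n+1]C[k+1])
open import Data.Integer as ℤ using (ℤ; +_; -[1+_])
import Data.Integer.Properties as ℤ
open import Data.Sign as Sign using (Sign)
open import Data.Fin using (toℕ)
open import Data.Fin.Properties using (toℕ<n)
open import Data.Maybe using (Maybe; just; nothing)
open import Data.Sum using (inj₁; inj₂)
open import Data.Product using (_×_; _,_)
open import Relation.Nullary using (yes; no)
open import Relation.Binary.PropositionalEquality as ≡ using (_≡_)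
import Algebra.Solver.Ring.AlmostCommutativeRing as ACR
import Algebra.Solver.Ring

module GKPTriangles {c ℓ : Level} (R : CommutativeRing c ℓ) where
  open CommutativeRing R
  open import Algebra.Properties.Ring ring
    using (-0#≈0#; -‿involutive; -1*x≈-x; -‿distribʳ-*; -‿+-comm)
  open import Algebra.Properties.CommutativeSemigroup *-commutativeSemigroup
    using (interchange)
  open import Algebra.Properties.Group +-group using (x≈y⇒x∙y⁻¹≈ε)
  open import Algebra.Properties.Semiring.Sum semiring
    using (sum; ∑-distrib-+; *-distribˡ-sum; sum-cong-≋; sum-replicate-zero)
  open import Relation.Binary.Reasoning.Setoid setoid

  infix 10 ⟨_⟩
  ⟨_⟩ : ℕ → Carrier
  ⟨_⟩ = fromℕ R

  fromℕ-+ : ∀ m n → ⟨ m ℕ.+ n ⟩ ≈ ⟨ m ⟩ + ⟨ n ⟩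
  fromℕ-+ zero    n = sym (+-identityˡ _)
  fromℕ-+ (suc m) n = trans (+-congˡ (fromℕ-+ m n)) (sym (+-assoc _ _ _))

  fromℕ-* : ∀ m n → ⟨ m ℕ.* n ⟩ ≈ ⟨ m ⟩ * ⟨ n ⟩
  fromℕ-* zero    n = sym (zeroˡ _)
  fromℕ-* (suc m) n = begin
    ⟨ n ℕ.+ m ℕ.* n ⟩          ≈⟨ fromℕ-+ n (m ℕ.* n) ⟩
    ⟨ n ⟩ + ⟨ m ℕ.* n ⟩        ≈⟨ +-cong (sym (*-identityˡ _)) (fromℕ-* m n) ⟩
    1# * ⟨ n ⟩ + ⟨ m ⟩ * ⟨ n ⟩ ≈⟨ distribʳ _ _ _ ⟨
    (1# + ⟨ m ⟩) * ⟨ n ⟩       ∎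

  -- Ring identities below are discharged by the ring solver with integer
  -- coefficients: ℤ maps into every commutative ring and has decidable equality.
  private
    fromℤ′ : ℤ → Carrier
    fromℤ′ (+ n)    = ⟨ n ⟩
    fromℤ′ -[1+ n ] = - ⟨ suc n ⟩

    sub-cancel-1# : ∀ x y → x - y ≈ (1# + x) - (1# + y)
    sub-cancel-1# x y = begin
      x - y                   ≈⟨ +-identityˡ _ ⟨
      0# + (x - y)            ≈⟨ +-congʳ (-‿inverseʳ 1#) ⟨
      (1# - 1#) + (x - y)     ≈⟨ +-assoc _ _ _ ⟩
      1# + (- 1# + (x - y))   ≈⟨ +-congˡ (+-assoc _ _ _) ⟨
      1# + ((- 1# + x) - y)   ≈⟨ +-congˡ (+-congʳ (+-comm _ _)) ⟩
      1# + ((x - 1#) - y)     ≈⟨ +-congˡ (+-assoc _ _ _) ⟩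
      1# + (x + (- 1# - y))   ≈⟨ +-assoc _ _ _ ⟨
      (1# + x) + (- 1# - y)   ≈⟨ +-congˡ (-‿+-comm _ _) ⟩
      (1# + x) - (1# + y)     ∎

    fromℤ′-⊖ : ∀ m n → fromℤ′ (m ℤ.⊖ n) ≈ ⟨ m ⟩ - ⟨ n ⟩
    fromℤ′-⊖ m       zero    = sym (trans (+-congˡ -0#≈0#) (+-identityʳ _))
    fromℤ′-⊖ zero    (suc n) = sym (+-identityˡ _)
    fromℤ′-⊖ (suc m) (suc n) = begin
      fromℤ′ (suc m ℤ.⊖ suc n)   ≡⟨ ≡.cong fromℤ′ (ℤ.[1+m]⊖[1+n]≡m⊖n m n) ⟩
      fromℤ′ (m ℤ.⊖ n)           ≈⟨ fromℤ′-⊖ m n ⟩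
      ⟨ m ⟩ - ⟨ n ⟩              ≈⟨ sub-cancel-1# _ _ ⟩
      ⟨ suc m ⟩ - ⟨ suc n ⟩      ∎

    fromℤ′-+ : ∀ i j → fromℤ′ (i ℤ.+ j) ≈ fromℤ′ i + fromℤ′ j
    fromℤ′-+ -[1+ m ] -[1+ n ] = begin
      - ⟨ suc (suc (m ℕ.+ n)) ⟩  ≡⟨ ≡.cong (λ k → - ⟨ k ⟩) (ℕ.+-suc (suc m) n) ⟨
      - ⟨ suc m ℕ.+ suc n ⟩      ≈⟨ -‿cong (fromℕ-+ (suc m) (suc n)) ⟩
      - (⟨ suc m ⟩ + ⟨ suc n ⟩)  ≈⟨ -‿+-comm _ _ ⟨
      - ⟨ suc m ⟩ + - ⟨ suc n ⟩  ∎
    fromℤ′-+ -[1+ m ] (+ n)    = trans (fromℤ′-⊖ n (suc m)) (+-comm _ _)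
    fromℤ′-+ (+ m)    -[1+ n ] = fromℤ′-⊖ m (suc n)
    fromℤ′-+ (+ m)    (+ n)    = fromℕ-+ m n

    fromSign : Sign → Carrier
    fromSign Sign.+ = 1#
    fromSign Sign.- = - 1#

    fromℤ′-◃ : ∀ s n → fromℤ′ (s ℤ.◃ n) ≈ fromSign s * ⟨ n ⟩
    fromℤ′-◃ s       zero    = sym (zeroʳ _)
    fromℤ′-◃ Sign.+  (suc n) = sym (*-identityˡ _)
    fromℤ′-◃ Sign.-  (suc n) = sym (-1*x≈-x _)

    fromSign-* : ∀ s t → fromSign (s Sign.* t) ≈ fromSign s * fromSign t
    fromSign-* Sign.+ t      = sym (*-identityˡ _)
    fromSign-* Sign.- Sign.+ = sym (*-identityʳ _)
    fromSign-* Sign.- Sign.- = begin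
      1#             ≈⟨ -‿involutive _ ⟨
      - (- 1#)       ≈⟨ -‿cong (-1*x≈-x _) ⟨
      - (- 1# * 1#)  ≈⟨ -‿distribʳ-* _ _ ⟩
      - 1# * - 1#    ∎

    fromℤ′-sign-abs : ∀ i → fromℤ′ i ≈ fromSign (ℤ.sign i) * ⟨ ℤ.∣ i ∣ ⟩
    fromℤ′-sign-abs i = trans (reflexive (≡.cong fromℤ′ (≡.sym (ℤ.◃-inverse i))))
                             (fromℤ′-◃ (ℤ.sign i) ℤ.∣ i ∣)

    fromℤ′-* : ∀ i j → fromℤ′ (i ℤ.* j) ≈ fromℤ′ i * fromℤ′ j
    fromℤ′-* i j = begin
      fromℤ′ (i ℤ.* j)
        ≈⟨ fromℤ′-◃ (ℤ.sign i Sign.* ℤ.sign j) (ℤ.∣ i ∣ ℕ.* ℤ.∣ j ∣) ⟩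
      fromSign (ℤ.sign i Sign.* ℤ.sign j) * ⟨ ℤ.∣ i ∣ ℕ.* ℤ.∣ j ∣ ⟩
        ≈⟨ *-cong (fromSign-* (ℤ.sign i) (ℤ.sign j)) (fromℕ-* ℤ.∣ i ∣ ℤ.∣ j ∣) ⟩
      (fromSign (ℤ.sign i) * fromSign (ℤ.sign j)) * (⟨ ℤ.∣ i ∣ ⟩ * ⟨ ℤ.∣ j ∣ ⟩)
        ≈⟨ interchange _ _ _ _ ⟩
      (fromSign (ℤ.sign i) * ⟨ ℤ.∣ i ∣ ⟩) * (fromSign (ℤ.sign j) * ⟨ ℤ.∣ j ∣ ⟩)
        ≈⟨ *-cong (fromℤ′-sign-abs i) (fromℤ′-sign-abs j) ⟨
      fromℤ′ i * fromℤ′ j ∎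

    fromℤ′-neg : ∀ i → fromℤ′ (ℤ.- i) ≈ - fromℤ′ i
    fromℤ′-neg -[1+ n ]     = sym (-‿involutive _)
    fromℤ′-neg (+ zero)     = sym -0#≈0#
    fromℤ′-neg (+ (suc n))  = refl

    -- Unlike ⟨ 1 ⟩ = 1# + 0#, the constant 1 of a solver expression must
    -- denote 1# itself, so that solved equations match goals definitionally.
    fromℤ : ℤ → Carrier
    fromℤ (+ 1) = 1#
    fromℤ i     = fromℤ′ i

    fromℤ≈fromℤ′ : ∀ i → fromℤ i ≈ fromℤ′ i
    fromℤ≈fromℤ′ (+ zero)          = refl
    fromℤ≈fromℤ′ (+ 1)             = sym (+-identityʳ 1#)
    fromℤ≈fromℤ′ (+ suc (suc n))   = refl
    fromℤ≈fromℤ′ -[1+ n ]          = refl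

    homo₂ : ∀ (_∙_ : ℤ → ℤ → ℤ) (_∘_ : Carrier → Carrier → Carrier) →
            (∀ i j → fromℤ′ (i ∙ j) ≈ fromℤ′ i ∘ fromℤ′ j) →
            (∀ {x y u v} → x ≈ y → u ≈ v → x ∘ u ≈ y ∘ v) →
            ∀ i j → fromℤ (i ∙ j) ≈ fromℤ i ∘ fromℤ j
    homo₂ _∙_ _∘_ homo′ cong i j = trans (fromℤ≈fromℤ′ (i ∙ j))
      (trans (homo′ i j) (cong (sym (fromℤ≈fromℤ′ i)) (sym (fromℤ≈fromℤ′ j))))

    fromℤ-homomorphism : ℤ.+-*-rawRing ACR.-Raw-AlmostCommutative⟶ ACR.fromCommutativeRing R
    fromℤ-homomorphism = record
      { ⟦_⟧    = fromℤ
      ; +-homo = homo₂ ℤ._+_ _+_ fromℤ′-+ +-cong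
      ; *-homo = homo₂ ℤ._*_ _*_ fromℤ′-* *-cong
      ; -‿homo = λ i → trans (fromℤ≈fromℤ′ (ℤ.- i))
                       (trans (fromℤ′-neg i) (-‿cong (sym (fromℤ≈fromℤ′ i))))
      ; 0-homo = refl
      ; 1-homo = refl
      }

    fromℤ-≟ : ∀ i j → Maybe (fromℤ i ≈ fromℤ j)
    fromℤ-≟ i j with i ℤ.≟ j
    ... | yes ≡.refl = just refl
    ... | no _       = nothing

  open Algebra.Solver.Ring ℤ.+-*-rawRing (ACR.fromCommutativeRing R) fromℤ-homomorphism fromℤ-≟
    using (solve; _:=_; _:+_; _:*_; :-_; _:-_; con)

  -- Opaque, so that unification recovers f from ∑< N f.
  opaque
    ∑< : ℕ → (ℕ → Carrier) → Carrier
    ∑< N f = sum {N} (λ i → f (toℕ i))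

    ∑<-suc : ∀ N f → ∑< (suc N) f ≈ f 0 + ∑< N (λ j → f (suc j))
    ∑<-suc N f = refl

    ∑<-cong : ∀ N {f g} → (∀ j → j < N → f j ≈ g j) → ∑< N f ≈ ∑< N g
    ∑<-cong N f≈g = sum-cong-≋ (λ i → f≈g (toℕ i) (toℕ<n i))

    ∑<-zero : ∀ N {f} → (∀ j → j < N → f j ≈ 0#) → ∑< N f ≈ 0#
    ∑<-zero N f≈0 = trans (∑<-cong N f≈0) (sum-replicate-zero N)

    ∑<-+ : ∀ N f g → ∑< N (λ j → f j + g j) ≈ ∑< N f + ∑< N g
    ∑<-+ N f g = ∑-distrib-+ {N} (λ i → f (toℕ i)) (λ i → g (toℕ i))

    ∑<-*ˡ : ∀ N x f → x * ∑< N f ≈ ∑< N (λ j → x * f j)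
    ∑<-*ˡ N x f = *-distribˡ-sum {N} x (λ i → f (toℕ i))

  ∑<-last : ∀ N f → ∑< (suc N) f ≈ ∑< N f + f N
  ∑<-last zero    f = begin
    ∑< 1 f              ≈⟨ ∑<-suc 0 f ⟩
    f 0 + ∑< 0 _        ≈⟨ +-congˡ (∑<-zero 0 (λ _ ())) ⟩
    f 0 + 0#            ≈⟨ +-comm _ _ ⟩
    0# + f 0            ≈⟨ +-congʳ (∑<-zero 0 (λ _ ())) ⟨
    ∑< 0 f + f 0        ∎
  ∑<-last (suc N) f = begin
    ∑< (suc (suc N)) f                            ≈⟨ ∑<-suc (suc N) f ⟩
    f 0 + ∑< (suc N) (λ j → f (suc j))            ≈⟨ +-congˡ (∑<-last N (λ j → f (suc j))) ⟩
    f 0 + (∑< N (λ j → f (suc j)) + f (suc N))    ≈⟨ +-assoc _ _ _ ⟨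
    f 0 + ∑< N (λ j → f (suc j)) + f (suc N)      ≈⟨ +-congʳ (∑<-suc N f) ⟨
    ∑< (suc N) f + f (suc N)                      ∎

  ∑<-split : ∀ m d f → ∑< (m ℕ.+ d) f ≈ ∑< m f + ∑< d (λ t → f (m ℕ.+ t))
  ∑<-split zero    d f = trans (sym (+-identityˡ _)) (+-congʳ (sym (∑<-zero 0 (λ _ ()))))
  ∑<-split (suc m) d f = begin
    ∑< (suc (m ℕ.+ d)) f                                                 ≈⟨ ∑<-suc (m ℕ.+ d) f ⟩
    f 0 + ∑< (m ℕ.+ d) (λ j → f (suc j))                                 ≈⟨ +-congˡ (∑<-split m d (λ j → f (suc j))) ⟩
    f 0 + (∑< m (λ j → f (suc j)) + ∑< d (λ t → f (suc m ℕ.+ t)))        ≈⟨ +-assoc _ _ _ ⟨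
    f 0 + ∑< m (λ j → f (suc j)) + ∑< d (λ t → f (suc m ℕ.+ t))          ≈⟨ +-congʳ (∑<-suc m f) ⟨
    ∑< (suc m) f + ∑< d (λ t → f (suc m ℕ.+ t))                          ∎

  ∑<-linear : ∀ N x y (f g h : ℕ → Carrier) →
              ∑< N (λ j → (x * f j + y * g j) * h j) ≈ x * ∑< N (λ j → f j * h j) + y * ∑< N (λ j → g j * h j)
  ∑<-linear N x y f g h = begin
    ∑< N (λ j → (x * f j + y * g j) * h j)
      ≈⟨ ∑<-cong N (λ j _ → solve 5 (λ x y f g h → (x :* f :+ y :* g) :* h := x :* (f :* h) :+ y :* (g :* h))
                                    refl x y (f j) (g j) (h j)) ⟩
    ∑< N (λ j → x * (f j * h j) + y * (g j * h j))
      ≈⟨ ∑<-+ N (λ j → x * (f j * h j)) (λ j → y * (g j * h j)) ⟩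
    ∑< N (λ j → x * (f j * h j)) + ∑< N (λ j → y * (g j * h j))
      ≈⟨ +-cong (∑<-*ˡ N x (λ j → f j * h j)) (∑<-*ˡ N y (λ j → g j * h j)) ⟨
    x * ∑< N (λ j → f j * h j) + y * ∑< N (λ j → g j * h j) ∎

  sumFromTo-step : ∀ k n f → k ≤ n → sumFromTo R k n f ≈ f k + sumFromTo R (suc k) n f
  sumFromTo-step k n f k≤n rewrite ℕ.+-∸-assoc 1 k≤n = refl

  sumFromTo-empty : ∀ n f → sumFromTo R (suc n) n f ≈ 0#
  sumFromTo-empty n f rewrite ℕ.n∸n≡0 n = refl

  sumFromTo≈∑<-shift : ∀ n f k d → k ℕ.+ d ≡ suc n → sumFromTo R k n f ≈ ∑< d (λ t → f (k ℕ.+ t))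
  sumFromTo≈∑<-shift n f k zero    k+0≡1+n rewrite ℕ.+-identityʳ k | k+0≡1+n =
    trans (sumFromTo-empty n f) (sym (∑<-zero 0 (λ _ ())))
  sumFromTo≈∑<-shift n f k (suc d) k+1+d≡1+n = begin
    sumFromTo R k n f
      ≈⟨ sumFromTo-step k n f k≤n ⟩
    f k + sumFromTo R (suc k) n f
      ≈⟨ +-cong (reflexive (≡.cong f (≡.sym (ℕ.+-identityʳ k)))) (sumFromTo≈∑<-shift n f (suc k) d 1+k+d≡1+n) ⟩
    f (k ℕ.+ 0) + ∑< d (λ t → f (suc k ℕ.+ t))
      ≈⟨ +-congˡ (∑<-cong d (λ t _ → reflexive (≡.cong f (≡.sym (ℕ.+-suc k t))))) ⟩
    f (k ℕ.+ 0) + ∑< d (λ t → f (k ℕ.+ suc t))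
      ≈⟨ ∑<-suc d (λ t → f (k ℕ.+ t)) ⟨
    ∑< (suc d) (λ t → f (k ℕ.+ t)) ∎
    where
    1+k+d≡1+n : suc k ℕ.+ d ≡ suc n
    1+k+d≡1+n = ≡.trans (≡.sym (ℕ.+-suc k d)) k+1+d≡1+n
    k≤n : k ≤ n
    k≤n = ℕ.≤-pred (≡.subst (suc k ≤_) 1+k+d≡1+n (ℕ.m≤m+n (suc k) d))

  sumFromTo≈∑< : ∀ k n f → k ≤ suc n → (∀ j → j < k → f j ≈ 0#) →
                       sumFromTo R k n f ≈ ∑< (suc n) f
  sumFromTo≈∑< k n f k≤1+n f≈0 = begin
    sumFromTo R k n f                         ≈⟨ sumFromTo≈∑<-shift n f k (suc n ∸ k) k+[1+n-k]≡1+n ⟩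
    ∑< (suc n ∸ k) (λ t → f (k ℕ.+ t))        ≈⟨ +-identityˡ _ ⟨
    0# + ∑< (suc n ∸ k) (λ t → f (k ℕ.+ t))   ≈⟨ +-congʳ (∑<-zero k f≈0) ⟨
    ∑< k f + ∑< (suc n ∸ k) (λ t → f (k ℕ.+ t)) ≈⟨ ∑<-split k (suc n ∸ k) f ⟨
    ∑< (k ℕ.+ (suc n ∸ k)) f                  ≡⟨ ≡.cong (λ m → ∑< m f) k+[1+n-k]≡1+n ⟩
    ∑< (suc n) f                              ∎
    where
    k+[1+n-k]≡1+n : k ℕ.+ (suc n ∸ k) ≡ suc n
    k+[1+n-k]≡1+n = ℕ.m+[n∸m]≡n k≤1+n

  pow-1# : ∀ m → pow R 1# m ≈ 1#
  pow-1# zero    = refl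
  pow-1# (suc m) = trans (*-identityˡ _) (pow-1# m)

  binomial : Carrier → ℕ → ℕ → Carrier
  binomial w j k = ⟨ j C k ⟩ * pow R w (j ∸ k)

  k>n⇒⟨nCk⟩*x≈0 : ∀ {n k} x → n < k → ⟨ n C k ⟩ * x ≈ 0#
  k>n⇒⟨nCk⟩*x≈0 x n<k = trans (*-congʳ (reflexive (≡.cong ⟨_⟩ (k>n⇒nCk≡0 n<k)))) (zeroˡ x)

  binomial-below : ∀ w {j k} → j < k → binomial w j k ≈ 0#
  binomial-below w {j} {k} = k>n⇒⟨nCk⟩*x≈0 (pow R w (j ∸ k))

  binomial-left : ∀ w j → binomial w (suc j) 0 ≈ w * binomial w j 0
  binomial-left w j = solve 3 (λ w x p → x :* (w :* p) := w :* (x :* p)) refl w ⟨ 1 ⟩ (pow R w j)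

  binomial-pascal : ∀ w j k → binomial w (suc j) (suc k) ≈ w * binomial w j (suc k) + binomial w j k
  binomial-pascal w j k = begin
    ⟨ suc j C suc k ⟩ * pow R w (j ∸ k)
      ≡⟨ ≡.cong (λ m → ⟨ m ⟩ * pow R w (j ∸ k)) (nCk+nC[k+1]≡[n+1]C[k+1] j k) ⟨
    ⟨ j C k ℕ.+ j C suc k ⟩ * pow R w (j ∸ k)
      ≈⟨ *-congʳ (fromℕ-+ (j C k) (j C suc k)) ⟩
    (⟨ j C k ⟩ + ⟨ j C suc k ⟩) * pow R w (j ∸ k)
      ≈⟨ distribʳ _ _ _ ⟩
    binomial w j k + ⟨ j C suc k ⟩ * pow R w (j ∸ k)
      ≈⟨ +-congˡ shifted ⟩
    binomial w j k + w * binomial w j (suc k)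
      ≈⟨ +-comm _ _ ⟩
    w * binomial w j (suc k) + binomial w j k ∎
    where
    shifted : ⟨ j C suc k ⟩ * pow R w (j ∸ k) ≈ w * binomial w j (suc k)
    shifted with ℕ.≤-<-connex j k
    ... | inj₁ j≤k = trans (k>n⇒⟨nCk⟩*x≈0 _ (s≤s j≤k)) (sym (trans (*-congˡ (binomial-below w (s≤s j≤k))) (zeroʳ w)))
    ... | inj₂ k<j rewrite ℕ.+-∸-assoc 1 k<j =
          solve 3 (λ w x p → x :* (w :* p) := w :* (x :* p)) refl w ⟨ j C suc k ⟩ (pow R w (j ∸ suc k))

  binomial-absorb : ∀ w j k → ⟨ j ⟩ * binomial w j k ≈ ⟨ k ⟩ * binomial w j k + w * (⟨ suc k ⟩ * binomial w j (suc k))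
  binomial-absorb w zero k = begin
    0# * binomial w 0 k
      ≈⟨ zeroˡ _ ⟩
    0#
      ≈⟨ trans (+-congˡ (zeroʳ w)) (+-identityʳ 0#) ⟨
    0# + w * 0#
      ≈⟨ +-cong (m*binomial-0≈0 k) (*-congˡ (m*binomial-0≈0 (suc k))) ⟨
    ⟨ k ⟩ * binomial w 0 k + w * (⟨ suc k ⟩ * binomial w 0 (suc k)) ∎
    where
    m*binomial-0≈0 : ∀ m → ⟨ m ⟩ * binomial w 0 m ≈ 0#
    m*binomial-0≈0 zero    = zeroˡ _
    m*binomial-0≈0 (suc m) = trans (*-congˡ (binomial-below w {0} {suc m} (s≤s z≤n))) (zeroʳ _)
  binomial-absorb w (suc j) zero = begin
    ⟨ suc j ⟩ * binomial w (suc j) 0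
      ≈⟨ *-congˡ (binomial-left w j) ⟩
    (1# + ⟨ j ⟩) * (w * u₀)
      ≈⟨ solve 3 (λ w J u₀ → (con (+ 1) :+ J) :* (w :* u₀) := w :* u₀ :+ w :* (J :* u₀)) refl w ⟨ j ⟩ u₀ ⟩
    w * u₀ + w * (⟨ j ⟩ * u₀)
      ≈⟨ +-congˡ (*-congˡ (binomial-absorb w j 0)) ⟩
    w * u₀ + w * (0# * u₀ + w * (⟨ 1 ⟩ * u₁))
      ≈⟨ solve 3 (λ w u₀ u₁ → w :* u₀ :+ w :* (con (+ 0) :* u₀ :+ w :* ((con (+ 1) :+ con (+ 0)) :* u₁))
                  := con (+ 0) :* (w :* u₀) :+ w :* ((con (+ 1) :+ con (+ 0)) :* (w :* u₁ :+ u₀)))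
                 refl w u₀ u₁ ⟩
    0# * (w * u₀) + w * (⟨ 1 ⟩ * (w * u₁ + u₀))
      ≈⟨ +-cong (*-congˡ (binomial-left w j)) (*-congˡ (*-congˡ (binomial-pascal w j 0))) ⟨
    ⟨ 0 ⟩ * binomial w (suc j) 0 + w * (⟨ 1 ⟩ * binomial w (suc j) 1) ∎
    where
    u₀ u₁ : Carrier
    u₀ = binomial w j 0
    u₁ = binomial w j 1
  binomial-absorb w (suc j) (suc k) = begin
    ⟨ suc j ⟩ * binomial w (suc j) (suc k)
      ≈⟨ *-congˡ (binomial-pascal w j k) ⟩
    (1# + ⟨ j ⟩) * (w * u₁ + u₀)
      ≈⟨ solve 4 (λ w J u₀ u₁ → (con (+ 1) :+ J) :* (w :* u₁ :+ u₀) := w :* u₁ :+ u₀ :+ w :* (J :* u₁) :+ J :* u₀)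
                 refl w ⟨ j ⟩ u₀ u₁ ⟩
    w * u₁ + u₀ + w * (⟨ j ⟩ * u₁) + ⟨ j ⟩ * u₀
      ≈⟨ +-cong (+-congˡ (*-congˡ (binomial-absorb w j (suc k)))) (binomial-absorb w j k) ⟩
    w * u₁ + u₀ + w * (⟨ suc k ⟩ * u₁ + w * (⟨ suc (suc k) ⟩ * u₂)) + (⟨ k ⟩ * u₀ + w * (⟨ suc k ⟩ * u₁))
      ≈⟨ solve 5 (λ w K u₀ u₁ u₂ →
              w :* u₁ :+ u₀ :+ w :* ((con (+ 1) :+ K) :* u₁ :+ w :* ((con (+ 1) :+ (con (+ 1) :+ K)) :* u₂))
                :+ (K :* u₀ :+ w :* ((con (+ 1) :+ K) :* u₁))
              := (con (+ 1) :+ K) :* (w :* u₁ :+ u₀) :+ w :* ((con (+ 1) :+ (con (+ 1) :+ K)) :* (w :* u₂ :+ u₁)))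
                 refl w ⟨ k ⟩ u₀ u₁ u₂ ⟩
    ⟨ suc k ⟩ * (w * u₁ + u₀) + w * (⟨ suc (suc k) ⟩ * (w * u₂ + u₁))
      ≈⟨ +-cong (*-congˡ (binomial-pascal w j k)) (*-congˡ (*-congˡ (binomial-pascal w j (suc k)))) ⟨
    ⟨ suc k ⟩ * binomial w (suc j) (suc k) + w * (⟨ suc (suc k) ⟩ * binomial w (suc j) (suc (suc k))) ∎
    where
    u₀ u₁ u₂ : Carrier
    u₀ = binomial w j k
    u₁ = binomial w j (suc k)
    u₂ = binomial w j (suc (suc k))

  affine : Carrier → Carrier → Carrier → ℕ → ℕ → Carrier
  affine α β γ n k = α * ⟨ n ⟩ + β * ⟨ k ⟩ + γ

  affine-cong : ∀ {α₁ β₁ γ₁ α₂ β₂ γ₂} → α₁ ≈ α₂ → β₁ ≈ β₂ → γ₁ ≈ γ₂ →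
                ∀ n k → affine α₁ β₁ γ₁ n k ≈ affine α₂ β₂ γ₂ n k
  affine-cong α≈ β≈ γ≈ n k = +-cong (+-cong (*-congʳ α≈) (*-congʳ β≈)) γ≈

  module _ {α β γ α′ β′ γ′ : Carrier} where

    private
      T : ℕ → ℕ → Carrier
      T = GKP R α β γ α′ β′ γ′

    n<k⇒GKP≈0 : ∀ {n k} → n < k → T n k ≈ 0#
    n<k⇒GKP≈0 {zero}  {suc k} _         = refl
    n<k⇒GKP≈0 {suc n} {suc k} (s≤s n<k) = begin
      _ * T n (suc k) + _ * T n k ≈⟨ +-cong (*-congˡ (n<k⇒GKP≈0 (ℕ.m<n⇒m<1+n n<k))) (*-congˡ (n<k⇒GKP≈0 n<k)) ⟩
      _ * 0# + _ * 0#             ≈⟨ +-cong (zeroʳ _) (zeroʳ _) ⟩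
      0# + 0#                     ≈⟨ +-identityʳ 0# ⟩
      0#                          ∎

    GKP-diagonal : ∀ n → T (suc n) (suc n) ≈ affine α′ β′ γ′ n n * T n n
    GKP-diagonal n = begin
      _ * T n (suc n) + _ * T n n ≈⟨ +-congʳ (*-congˡ (n<k⇒GKP≈0 (ℕ.n<1+n n))) ⟩
      _ * 0# + _ * T n n          ≈⟨ +-congʳ (zeroʳ _) ⟩
      0# + _ * T n n              ≈⟨ +-identityˡ _ ⟩
      _ * T n n                   ∎

  record IsGKP (α β γ α′ β′ γ′ : Carrier) (T : ℕ → ℕ → Carrier) : Set (c ⊔ ℓ) where
    field
      corner   : T 0 0 ≈ 1#
      left     : ∀ n → T (suc n) 0 ≈ affine α β γ n 0 * T n 0
      interior : ∀ n k → k < n →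
                 T (suc n) (suc k) ≈ affine α β γ n (suc k) * T n (suc k) + affine α′ β′ γ′ n k * T n k
      diagonal : ∀ n → T (suc n) (suc n) ≈ affine α′ β′ γ′ n n * T n n

  IsGKP⇒≈GKP : ∀ {α β γ α′ β′ γ′ T} → IsGKP α β γ α′ β′ γ′ T →
               ∀ n k → k ≤ n → T n k ≈ GKP R α β γ α′ β′ γ′ n k
  IsGKP⇒≈GKP {α} {β} {γ} {α′} {β′} {γ′} {T} isGKP = go
    where
    open IsGKP isGKP
    go : ∀ n k → k ≤ n → T n k ≈ GKP R α β γ α′ β′ γ′ n k
    go zero    zero    _ = corner
    go (suc n) zero    _ = trans (left n) (*-congˡ (go n 0 z≤n))
    go (suc n) (suc k) (s≤s k≤n) with ℕ.m≤n⇒m<n∨m≡n k≤n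
    ... | inj₁ k<n    = trans (interior n k k<n) (+-cong (*-congˡ (go n (suc k) k<n)) (*-congˡ (go n k k≤n)))
    ... | inj₂ ≡.refl = trans (diagonal n) (trans (*-congˡ (go n n k≤n)) (sym (GKP-diagonal n)))

  GKP-cong : ∀ {α₁ β₁ γ₁ α₁′ β₁′ γ₁′ α₂ β₂ γ₂ α₂′ β₂′ γ₂′} →
             α₁ ≈ α₂ → β₁ ≈ β₂ → γ₁ ≈ γ₂ → α₁′ ≈ α₂′ → β₁′ ≈ β₂′ → γ₁′ ≈ γ₂′ →
             ∀ n k → GKP R α₁ β₁ γ₁ α₁′ β₁′ γ₁′ n k ≈ GKP R α₂ β₂ γ₂ α₂′ β₂′ γ₂′ n k
  GKP-cong α≈ β≈ γ≈ α′≈ β′≈ γ′≈ zero    zero    = refl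
  GKP-cong α≈ β≈ γ≈ α′≈ β′≈ γ′≈ zero    (suc k) = refl
  GKP-cong α≈ β≈ γ≈ α′≈ β′≈ γ′≈ (suc n) zero    =
    *-cong (affine-cong α≈ β≈ γ≈ n 0) (GKP-cong α≈ β≈ γ≈ α′≈ β′≈ γ′≈ n 0)
  GKP-cong α≈ β≈ γ≈ α′≈ β′≈ γ′≈ (suc n) (suc k) =
    +-cong (*-cong (affine-cong α≈ β≈ γ≈ n (suc k)) (GKP-cong α≈ β≈ γ≈ α′≈ β′≈ γ′≈ n (suc k)))
           (*-cong (affine-cong α′≈ β′≈ γ′≈ n k) (GKP-cong α≈ β≈ γ≈ α′≈ β′≈ γ′≈ n k))

  rising*GKP≈GKP : ∀ {α β γ} x d n k →
                   rising R x d k * GKP R α β γ 0# 0# 1# n k ≈ GKP R α β γ 0# d x n k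
  rising*GKP≈GKP x d zero    zero    = *-identityˡ 1#
  rising*GKP≈GKP x d zero    (suc k) = zeroʳ _
  rising*GKP≈GKP x d (suc n) zero    =
    trans (*-identityˡ _) (*-congˡ (trans (sym (*-identityˡ _)) (rising*GKP≈GKP x d n 0)))
  rising*GKP≈GKP {α} {β} {γ} x d (suc n) (suc k) = begin
    (r * (x + ⟨ k ⟩ * d)) * (A * U (suc k) + (0# * ⟨ n ⟩ + 0# * ⟨ k ⟩ + 1#) * U k)
      ≈⟨ solve 8 (λ r x K d A S₁ N S₀ →
            (r :* (x :+ K :* d)) :* (A :* S₁ :+ (con (+ 0) :* N :+ con (+ 0) :* K :+ con (+ 1)) :* S₀)
            := A :* ((r :* (x :+ K :* d)) :* S₁) :+ (con (+ 0) :* N :+ d :* K :+ x) :* (r :* S₀))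
          refl r x ⟨ k ⟩ d A (U (suc k)) ⟨ n ⟩ (U k) ⟩
    A * (rising R x d (suc k) * U (suc k)) + affine 0# d x n k * (r * U k)
      ≈⟨ +-cong (*-congˡ (rising*GKP≈GKP x d n (suc k))) (*-congˡ (rising*GKP≈GKP x d n k)) ⟩
    GKP R α β γ 0# d x (suc n) (suc k) ∎
    where
    r A : Carrier
    r = rising R x d k
    A = affine α β γ n (suc k)
    U : ℕ → Carrier
    U = GKP R α β γ 0# 0# 1# n

  affine-reflect : ∀ α β γ {n} i j → i ℕ.+ j ≡ n → affine α β γ n i ≈ affine (α + β) (- β) γ n j
  affine-reflect α β γ i j ≡.refl = begin
    α * ⟨ i ℕ.+ j ⟩ + β * ⟨ i ⟩ + γ                   ≈⟨ +-congʳ (+-congʳ (*-congˡ (fromℕ-+ i j))) ⟩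
    α * (⟨ i ⟩ + ⟨ j ⟩) + β * ⟨ i ⟩ + γ               ≈⟨ solve 5 (λ α β γ I J →
                                                           α :* (I :+ J) :+ β :* I :+ γ
                                                           := (α :+ β) :* (I :+ J) :+ (:- β) :* J :+ γ)
                                                         refl α β γ ⟨ i ⟩ ⟨ j ⟩ ⟩
    (α + β) * (⟨ i ⟩ + ⟨ j ⟩) + (- β) * ⟨ j ⟩ + γ     ≈⟨ +-congʳ (+-congʳ (*-congˡ (fromℕ-+ i j))) ⟨
    (α + β) * ⟨ i ℕ.+ j ⟩ + (- β) * ⟨ j ⟩ + γ         ∎

  GKP-reflect : ∀ {α β γ α′ β′ γ′} n k → k ≤ n →
                GKP R α β γ α′ β′ γ′ n (n ∸ k) ≈ GKP R (α′ + β′) (- β′) γ′ (α + β) (- β) γ n k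
  GKP-reflect {α} {β} {γ} {α′} {β′} {γ′} = IsGKP⇒≈GKP (record
    { corner   = refl
    ; left     = λ n → trans (GKP-diagonal n) (*-congʳ (affine-reflect α′ β′ γ′ n 0 (ℕ.+-identityʳ n)))
    ; interior = interior
    ; diagonal = diagonal
    })
    where
    T : ℕ → ℕ → Carrier
    T = GKP R α β γ α′ β′ γ′

    interior : ∀ n k → k < n →
               T (suc n) (n ∸ k) ≈ affine (α′ + β′) (- β′) γ′ n (suc k) * T n (n ∸ suc k)
                                 + affine (α + β) (- β) γ n k * T n (n ∸ k)
    interior n k k<n = begin
      T (suc n) (n ∸ k)
        ≡⟨ ≡.cong (T (suc n)) n-k≡1+d ⟩
      affine α β γ n (suc d) * T n (suc d) + affine α′ β′ γ′ n d * T n d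
        ≈⟨ +-comm _ _ ⟩
      affine α′ β′ γ′ n d * T n d + affine α β γ n (suc d) * T n (suc d)
        ≈⟨ +-cong (*-congʳ (affine-reflect α′ β′ γ′ d (suc k) d+1+k≡n))
                  (*-cong (affine-reflect α β γ (suc d) k (≡.trans (≡.sym (ℕ.+-suc d k)) d+1+k≡n))
                          (reflexive (≡.cong (T n) (≡.sym n-k≡1+d)))) ⟩
      _ ∎
      where
      d : ℕ
      d = n ∸ suc k
      n-k≡1+d : n ∸ k ≡ suc d
      n-k≡1+d = ℕ.+-∸-assoc 1 k<n
      d+1+k≡n : d ℕ.+ suc k ≡ n
      d+1+k≡n = ℕ.m∸n+n≡m k<n

    diagonal : ∀ n → T (suc n) (n ∸ n) ≈ affine (α + β) (- β) γ n n * T n (n ∸ n)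
    diagonal n = begin
      T (suc n) (n ∸ n)                     ≡⟨ ≡.cong (T (suc n)) (ℕ.n∸n≡0 n) ⟩
      affine α β γ n 0 * T n 0              ≈⟨ *-cong (affine-reflect α β γ 0 n ≡.refl)
                                                      (reflexive (≡.cong (T n) (≡.sym (ℕ.n∸n≡0 n)))) ⟩
      affine (α + β) (- β) γ n n * T n (n ∸ n) ∎

  module BinomialTransform (α β γ α′ β′ γ′ w : Carrier) where

    private
      T : ℕ → ℕ → Carrier
      T = GKP R α β γ α′ β′ γ′

      A B X : ℕ → ℕ → Carrier
      A = affine α β γ
      B = affine α′ β′ γ′
      X = affine (α + w * α′) (w * β′) (γ + w * γ′)

    transform : ℕ → ℕ → Carrier
    transform n k = ∑< (suc n) (λ j → binomial w j k * T n j)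

    transform-above-diagonal : ∀ n → transform n (suc n) ≈ 0#
    transform-above-diagonal n = ∑<-zero (suc n) (λ j j<1+n → trans (*-congʳ (binomial-below w j<1+n)) (zeroˡ _))

    transform-step : ∀ n k → transform (suc n) k ≈
                     ∑< (suc n) (λ j → (binomial w j k * A n j + binomial w (suc j) k * B n j) * T n j)
    transform-step n k = begin
      transform (suc n) k
        ≈⟨ ∑<-suc (suc n) (λ j → binomial w j k * T (suc n) j) ⟩
      p 0 + ∑< (suc n) (λ j → binomial w (suc j) k * (A n (suc j) * T n (suc j) + B n j * T n j))
        ≈⟨ +-congˡ (trans (∑<-cong (suc n) (λ j _ → distribˡ _ _ _)) (∑<-+ (suc n) (λ j → p (suc j)) q)) ⟩
      p 0 + (∑< (suc n) (λ j → p (suc j)) + ∑< (suc n) q)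
        ≈⟨ +-assoc _ _ _ ⟨
      p 0 + ∑< (suc n) (λ j → p (suc j)) + ∑< (suc n) q
        ≈⟨ +-congʳ (trans (sym (∑<-suc (suc n) p)) (∑<-last (suc n) p)) ⟩
      ∑< (suc n) p + p (suc n) + ∑< (suc n) q
        ≈⟨ +-congʳ (trans (+-congˡ p-top≈0) (+-identityʳ _)) ⟩
      ∑< (suc n) p + ∑< (suc n) q
        ≈⟨ ∑<-+ (suc n) p q ⟨
      ∑< (suc n) (λ j → p j + q j)
        ≈⟨ ∑<-cong (suc n) (λ j _ → solve 5 (λ x y u v z → x :* (y :* z) :+ u :* (v :* z) := (x :* y :+ u :* v) :* z)
                                             refl (binomial w j k) (A n j) (binomial w (suc j) k) (B n j) (T n j)) ⟩
      ∑< (suc n) (λ j → (binomial w j k * A n j + binomial w (suc j) k * B n j) * T n j) ∎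
      where
      p q : ℕ → Carrier
      p j = binomial w j k * (A n j * T n j)
      q j = binomial w (suc j) k * (B n j * T n j)
      p-top≈0 : p (suc n) ≈ 0#
      p-top≈0 = trans (*-congˡ (trans (*-congˡ (n<k⇒GKP≈0 (ℕ.n<1+n n))) (zeroʳ _))) (zeroʳ _)

    module _ (cancel : β + w * β′ ≈ 0#) where

      left-coefficient : ∀ n j → binomial w j 0 * A n j + binomial w (suc j) 0 * B n j ≈ X n 0 * binomial w j 0
      left-coefficient n j = begin
        u * A n j + binomial w (suc j) 0 * B n j
          ≈⟨ +-congˡ (*-congʳ (binomial-left w j)) ⟩
        u * A n j + (w * u) * B n j
          ≈⟨ solve 10 (λ α β γ α′ β′ γ′ w N J u →
                u :* (α :* N :+ β :* J :+ γ) :+ (w :* u) :* (α′ :* N :+ β′ :* J :+ γ′)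
                := ((α :+ w :* α′) :* N :+ (w :* β′) :* con (+ 0) :+ (γ :+ w :* γ′)) :* u :+ (β :+ w :* β′) :* (J :* u))
              refl α β γ α′ β′ γ′ w ⟨ n ⟩ ⟨ j ⟩ u ⟩
        X n 0 * u + (β + w * β′) * (⟨ j ⟩ * u)
          ≈⟨ +-congˡ (trans (*-congʳ cancel) (zeroˡ _)) ⟩
        X n 0 * u + 0#
          ≈⟨ +-identityʳ _ ⟩
        X n 0 * u ∎
        where
        u : Carrier
        u = binomial w j 0

      interior-coefficient : ∀ n j k →
        binomial w j (suc k) * A n j + binomial w (suc j) (suc k) * B n j ≈ X n (suc k) * binomial w j (suc k) + B n k * binomial w j k
      interior-coefficient n j k = begin
        u * A n j + binomial w (suc j) (suc k) * B n j
          ≈⟨ +-congˡ (*-congʳ (binomial-pascal w j k)) ⟩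
        u * A n j + (w * u + v) * B n j
          ≈⟨ solve 12 (λ α β γ α′ β′ γ′ w N J K u v →
                u :* (α :* N :+ β :* J :+ γ) :+ (w :* u :+ v) :* (α′ :* N :+ β′ :* J :+ γ′)
                := ((α :+ w :* α′) :* N :+ (w :* β′) :* (con (+ 1) :+ K) :+ (γ :+ w :* γ′)) :* u
                     :+ (α′ :* N :+ β′ :* K :+ γ′) :* v
                   :+ ((β :+ w :* β′) :* (J :* u) :+ β′ :* (J :* v :- (K :* v :+ w :* ((con (+ 1) :+ K) :* u)))))
              refl α β γ α′ β′ γ′ w ⟨ n ⟩ ⟨ j ⟩ ⟨ k ⟩ u v ⟩
        X n (suc k) * u + B n k * v
          + ((β + w * β′) * (⟨ j ⟩ * u) + β′ * (⟨ j ⟩ * v - (⟨ k ⟩ * v + w * (⟨ suc k ⟩ * u))))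
          ≈⟨ +-congˡ (+-cong (trans (*-congʳ cancel) (zeroˡ _))
                             (trans (*-congˡ (x≈y⇒x∙y⁻¹≈ε (binomial-absorb w j k))) (zeroʳ _))) ⟩
        X n (suc k) * u + B n k * v + (0# + 0#)
          ≈⟨ trans (+-congˡ (+-identityʳ 0#)) (+-identityʳ _) ⟩
        X n (suc k) * u + B n k * v ∎
        where
        u v : Carrier
        u = binomial w j (suc k)
        v = binomial w j k

      transform-recurrence : ∀ n k → transform (suc n) (suc k) ≈ X n (suc k) * transform n (suc k) + B n k * transform n k
      transform-recurrence n k = begin
        transform (suc n) (suc k)
          ≈⟨ transform-step n (suc k) ⟩
        ∑< (suc n) (λ j → (binomial w j (suc k) * A n j + binomial w (suc j) (suc k) * B n j) * T n j)
          ≈⟨ ∑<-cong (suc n) (λ j _ → *-congʳ (interior-coefficient n j k)) ⟩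
        ∑< (suc n) (λ j → (X n (suc k) * binomial w j (suc k) + B n k * binomial w j k) * T n j)
          ≈⟨ ∑<-linear (suc n) (X n (suc k)) (B n k) (λ j → binomial w j (suc k)) (λ j → binomial w j k) (T n) ⟩
        X n (suc k) * transform n (suc k) + B n k * transform n k ∎

      transform-isGKP : IsGKP (α + w * α′) (w * β′) (γ + w * γ′) α′ β′ γ′ transform
      transform-isGKP = record
        { corner   = begin
            transform 0 0
              ≈⟨ ∑<-suc 0 (λ j → binomial w j 0 * T 0 j) ⟩
            ((1# + 0#) * 1#) * 1# + ∑< 0 _
              ≈⟨ +-congˡ (∑<-zero 0 (λ _ ())) ⟩
            ((1# + 0#) * 1#) * 1# + 0#
              ≈⟨ solve 0 (((con (+ 1) :+ con (+ 0)) :* con (+ 1)) :* con (+ 1) :+ con (+ 0) := con (+ 1)) refl ⟩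
            1# ∎
        ; left     = λ n → begin
            transform (suc n) 0
              ≈⟨ transform-step n 0 ⟩
            ∑< (suc n) (λ j → (binomial w j 0 * A n j + binomial w (suc j) 0 * B n j) * T n j)
              ≈⟨ ∑<-cong (suc n) (λ j _ → trans (*-congʳ (left-coefficient n j)) (*-assoc _ _ _)) ⟩
            ∑< (suc n) (λ j → X n 0 * (binomial w j 0 * T n j))
              ≈⟨ ∑<-*ˡ (suc n) (X n 0) (λ j → binomial w j 0 * T n j) ⟨
            X n 0 * transform n 0 ∎
        ; interior = λ n k _ → transform-recurrence n k
        ; diagonal = λ n → begin
            transform (suc n) (suc n)
              ≈⟨ transform-recurrence n n ⟩
            X n (suc n) * transform n (suc n) + B n n * transform n n
              ≈⟨ +-congʳ (trans (*-congˡ (transform-above-diagonal n)) (zeroʳ _)) ⟩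
            0# + B n n * transform n n
              ≈⟨ +-identityˡ _ ⟩
            B n n * transform n n ∎
        }

  binomial-transform : ∀ {α β γ α′ β′ γ′} w → β + w * β′ ≈ 0# → ∀ n k → k ≤ n →
    ∑< (suc n) (λ j → binomial w j k * GKP R α β γ α′ β′ γ′ n j)
      ≈ GKP R (α + w * α′) (w * β′) (γ + w * γ′) α′ β′ γ′ n k
  binomial-transform {α} {β} {γ} {α′} {β′} {γ′} w cancel =
    IsGKP⇒≈GKP (BinomialTransform.transform-isGKP α β γ α′ β′ γ′ w cancel)

  module Eulerian (a b c₀ c∞ : Carrier) where

    private
      F : ℕ → ℕ → Carrier
      F n k = rising R (c₀ + c∞) b (n ∸ k) * S R (- a) b c∞ n (n ∸ k)

    rising*Stirling≈GKP : ∀ n k → k ≤ n → F n k ≈ GKP R b (- b) (c₀ + c∞) (a + b) (- b) c∞ n k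
    rising*Stirling≈GKP n k k≤n = begin
      F n k                                                      ≈⟨ rising*GKP≈GKP (c₀ + c∞) b n (n ∸ k) ⟩
      GKP R (- (- a)) b c∞ 0# b (c₀ + c∞) n (n ∸ k)              ≈⟨ GKP-reflect n k k≤n ⟩
      GKP R (0# + b) (- b) (c₀ + c∞) (- (- a) + b) (- b) c∞ n k  ≈⟨ GKP-cong (+-identityˡ b) refl refl
                                                                              (+-congʳ (-‿involutive a)) refl refl n k ⟩
      GKP R b (- b) (c₀ + c∞) (a + b) (- b) c∞ n k               ∎

    rising*Stirling≈∑Eulerian : ∀ n k → k ≤ n → F n k ≈ sumFromTo R k n (λ j → ⟨ j C k ⟩ * E R a b c₀ c∞ n j)
    rising*Stirling≈∑Eulerian n k k≤n = begin
      F n k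
        ≈⟨ rising*Stirling≈GKP n k k≤n ⟩
      GKP R b (- b) (c₀ + c∞) (a + b) (- b) c∞ n k
        ≈⟨ GKP-cong (solve 2 (λ a b → :- a :+ con (+ 1) :* (a :+ b) := b) refl a b)
                    (solve 1 (λ b → con (+ 1) :* (:- b) := :- b) refl b)
                    (solve 2 (λ c₀ c∞ → c₀ :+ con (+ 1) :* c∞ := c₀ :+ c∞) refl c₀ c∞) refl refl refl n k ⟨
      GKP R (- a + 1# * (a + b)) (1# * - b) (c₀ + 1# * c∞) (a + b) (- b) c∞ n k
        ≈⟨ binomial-transform 1# (solve 1 (λ b → b :+ con (+ 1) :* (:- b) := con (+ 0)) refl b) n k k≤n ⟨
      ∑< (suc n) (λ j → binomial 1# j k * E R a b c₀ c∞ n j)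
        ≈⟨ ∑<-cong (suc n) (λ j _ → *-congʳ (trans (*-congˡ (pow-1# (j ∸ k))) (*-identityʳ _))) ⟩
      ∑< (suc n) (λ j → ⟨ j C k ⟩ * E R a b c₀ c∞ n j)
        ≈⟨ sumFromTo≈∑< k n _ (ℕ.m≤n⇒m≤1+n k≤n) (λ j → k>n⇒⟨nCk⟩*x≈0 (E R a b c₀ c∞ n j)) ⟨
      sumFromTo R k n (λ j → ⟨ j C k ⟩ * E R a b c₀ c∞ n j) ∎

    Eulerian≈∑signed-Stirling : ∀ n k → k ≤ n →
      E R a b c₀ c∞ n k ≈ sumFromTo R k n (λ j → sign R (j ∸ k) * ⟨ j C k ⟩
                                               * rising R (c₀ + c∞) b (n ∸ j) * S R (- a) b c∞ n (n ∸ j))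
    Eulerian≈∑signed-Stirling n k k≤n = begin
      E R a b c₀ c∞ n k
        ≈⟨ GKP-cong (solve 2 (λ a b → b :+ (:- con (+ 1)) :* (a :+ b) := :- a) refl a b)
                    (solve 1 (λ b → (:- con (+ 1)) :* (:- b) := b) refl b)
                    (solve 2 (λ c₀ c∞ → c₀ :+ c∞ :+ (:- con (+ 1)) :* c∞ := c₀) refl c₀ c∞) refl refl refl n k ⟨
      GKP R (b + - 1# * (a + b)) (- 1# * - b) (c₀ + c∞ + - 1# * c∞) (a + b) (- b) c∞ n k
        ≈⟨ binomial-transform (- 1#) (solve 1 (λ b → :- b :+ (:- con (+ 1)) :* (:- b) := con (+ 0)) refl b) n k k≤n ⟨
      ∑< (suc n) (λ j → binomial (- 1#) j k * GKP R b (- b) (c₀ + c∞) (a + b) (- b) c∞ n j)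
        ≈⟨ ∑<-cong (suc n) (λ j j<1+n → trans (*-congˡ (sym (rising*Stirling≈GKP n j (ℕ.≤-pred j<1+n)))) (reorder j)) ⟩
      ∑< (suc n) summand
        ≈⟨ sumFromTo≈∑< k n summand (ℕ.m≤n⇒m≤1+n k≤n)
                         (λ j j<k → trans (sym (reorder j)) (trans (*-congʳ (binomial-below (- 1#) j<k)) (zeroˡ _))) ⟨
      sumFromTo R k n summand ∎
      where
      summand : ℕ → Carrier
      summand j = sign R (j ∸ k) * ⟨ j C k ⟩ * rising R (c₀ + c∞) b (n ∸ j) * S R (- a) b c∞ n (n ∸ j)
      reorder : ∀ j → binomial (- 1#) j k * F n j ≈ summand j
      reorder j = solve 4 (λ c p r s → (c :* p) :* (r :* s) := p :* c :* r :* s)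
                          refl ⟨ j C k ⟩ (sign R (j ∸ k)) (rising R (c₀ + c∞) b (n ∸ j)) (S R (- a) b c∞ n (n ∸ j))

theorem4p7 : {c ℓ : Level} (R : CommutativeRing c ℓ) →
    let open CommutativeRing R in
    (n k : ℕ) → k ≤ n → (a b c₀ c∞ : Carrier) →
      (E R a b c₀ c∞ n k ≈
        sumFromTo R k n (λ j → sign R (j ∸ k) * fromℕ R (j C k)
          * rising R (c₀ + c∞) b (n ∸ j) * S R (- a) b c∞ n (n ∸ j)))
      ×
      (rising R (c₀ + c∞) b (n ∸ k) * S R (- a) b c∞ n (n ∸ k) ≈
        sumFromTo R k n (λ j → fromℕ R (j C k) * E R a b c₀ c∞ n j))
theorem4p7 R n k k≤n a b c₀ c∞ = Eulerian≈∑signed-Stirling n k k≤n , rising*Stirling≈∑Eulerian n k k≤n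
  where open GKPTriangles.Eulerian R a b c₀ c∞
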